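{- Let $G$ be a bridgeless cubic graph with $\tau(G)\le 4$. Then every cycle cover of $G$ of minimum length is a $(1,2)$-cover.
   Context: The perfect matching index $\tau(G)$ of a bridgeless cubic graph is the smallest integer $k$ such that there exist perfect matchings $M_1,\dots,M_k$ of $G$ whose union is $E(G)$. A cycle cover of $G$ is a collection of cycles covering every edge at least once; its length is the sum of the lengths of its cycles. A $(1,2)$-cover is a cycle cover in which every edge lies in either one or two of the cycles. -}

module Defs where

open import Data.Nat using (ℕ; _+_; _≤_; _%_)
open import Data.Bool using (Bool; true; false; if_then_else_)
open import Data.Fin using (Fin; _≟_)
open import Data.List using (List; map; allFin; length)
open import Data.Nat.ListAction using (sum)
open import Data.List.Membership.Propositional using (_∈_)
open import Data.Sum using (_⊎_)
open import Data.Product using (_×_; proj₁; proj₂; ∃; ∃-syntax; Σ-syntax)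
open import Relation.Nullary using (¬_; does)
open import Relation.Binary.PropositionalEquality using (_≡_)

-- A finite multigraph: vertices Fin n, edges Fin m, each edge has two ends.
-- (Parallel edges allowed; loops are representable but are excluded by
-- cubic + bridgeless.)
record Graph : Set where
  field
    n    : ℕ
    m    : ℕ
    ends : Fin m → Fin n × Fin n

open Graph public

EdgeSet : Graph → Set
EdgeSet G = Fin (m G) → Bool

[_] : Bool → ℕ
[ true ]  = 1
[ false ] = 0

-- number of ends of edge e at vertex v (a loop counts twice)
inc : (G : Graph) → Fin (m G) → Fin (n G) → ℕ
inc G e v = [ does (proj₁ (ends G e) ≟ v) ] + [ does (proj₂ (ends G e) ≟ v) ]

deg : (G : Graph) → EdgeSet G → Fin (n G) → ℕ
deg G S v = sum (map (λ e → if S e then inc G e v else 0) (allFin (m G)))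

allEdges : (G : Graph) → EdgeSet G
allEdges G _ = true

Cubic : Graph → Set
Cubic G = ∀ v → deg G (allEdges G) v ≡ 3

data Reach (G : Graph) (f : Fin (m G)) : Fin (n G) → Fin (n G) → Set where
  here : ∀ {v} → Reach G f v v
  step : ∀ {u w} (e : Fin (m G)) → ¬ (e ≡ f) →
         ((proj₁ (ends G e) ≡ u × proj₂ (ends G e) ≡ w) ⊎ (proj₂ (ends G e) ≡ u × proj₁ (ends G e) ≡ w)) →
         ∀ {v} → Reach G f w v → Reach G f u v

Bridge : (G : Graph) → Fin (m G) → Set
Bridge G e = ¬ Reach G e (proj₁ (ends G e)) (proj₂ (ends G e))

Bridgeless : Graph → Set
Bridgeless G = ∀ e → ¬ Bridge G e

PerfectMatching : (G : Graph) → EdgeSet G → Set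
PerfectMatching G M = ∀ v → deg G M v ≡ 1

-- τ(G) ≤ k : there are at most k perfect matchings whose union is E(G)
PMIndexAtMost : Graph → ℕ → Set
PMIndexAtMost G k = ∃[ j ] (j ≤ k × Σ[ M ∈ (Fin j → EdgeSet G) ]
  ((∀ i → PerfectMatching G (M i)) × (∀ e → ∃[ i ] M i e ≡ true)))

-- a cycle: a (spanning) subgraph in which every vertex has even degree
IsCycle : (G : Graph) → EdgeSet G → Set
IsCycle G C = ∀ v → deg G C v % 2 ≡ 0

size : (G : Graph) → EdgeSet G → ℕ
size G C = sum (map (λ e → [ C e ]) (allFin (m G)))

IsCycleCover : (G : Graph) → List (EdgeSet G) → Set
IsCycleCover G 𝒞 = (∀ C → C ∈ 𝒞 → IsCycle G C) ×
                   (∀ e → ∃[ C ] (C ∈ 𝒞 × C e ≡ true))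

coverLength : (G : Graph) → List (EdgeSet G) → ℕ
coverLength G 𝒞 = sum (map (size G) 𝒞)

multiplicity : (G : Graph) → List (EdgeSet G) → Fin (m G) → ℕ
multiplicity G 𝒞 e = sum (map (λ C → [ C e ]) 𝒞)

IsMinimumCycleCover : (G : Graph) → List (EdgeSet G) → Set
IsMinimumCycleCover G 𝒞 = IsCycleCover G 𝒞 ×
  (∀ 𝒟 → IsCycleCover G 𝒟 → coverLength G 𝒞 ≤ coverLength G 𝒟)

Is12Cover : (G : Graph) → List (EdgeSet G) → Set
Is12Cover G 𝒞 = IsCycleCover G 𝒞 × (∀ e → 1 ≤ multiplicity G 𝒞 e × multiplicity G 𝒞 e ≤ 2)

-- Let M₀, …, M₃ be perfect matchings covering E(G) (repeating one if τ(G) < 4). Every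
-- vertex lies on exactly four matching edges counted with repetition, and each of its three
-- edges on at least one, so no edge lies in all four matchings. Let Cᵢ be the complement of
-- the symmetric difference of the three matchings other than Mᵢ; in a cubic graph it is an
-- even subgraph. An edge lying in exactly k ∈ {1,2,3} of the matchings lies in exactly k of
-- the Cᵢ, so C₀, …, C₃ is a cycle cover of length Σ|Mᵢ| = 2|V|.
-- For any cycle cover, the sum of the multiplicities of the edges at a vertex is even and at
-- least 3, hence at least 4, while summing over all vertices gives twice the length. A
-- minimum cover has length at most 2|V|, so every vertex has weight exactly 4, which leaves
-- no room for an edge of multiplicity 3 or more.
module Submission where

open import Defs
open import Algebra.Properties.CommutativeSemigroup using (interchange; x∙yz≈y∙xz)
open import Data.Bool using (Bool; true; false; not; _xor_; _∧_; _∨_; if_then_else_)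
open import Data.Fin using (Fin; zero; suc; inject≤; #_; _≟_)
open import Data.Fin.Properties using (¬Fin0)
open import Data.List using (List; []; _∷_; map; allFin; length)
open import Data.List.Membership.Propositional using (_∈_)
open import Data.List.Membership.Propositional.Properties using (∈-allFin; ∈-map⁺)
open import Data.List.Properties using (map-cong; map-tabulate; length-tabulate)
open import Data.List.Relation.Unary.All using (All; []; _∷_; lookup)
open import Data.List.Relation.Unary.Any using (here; there)
open import Data.Nat using (ℕ; zero; suc; _+_; _*_; _≤_; _%_; z≤n; s≤s; NonZero; >-nonZero; _≤?_)
open import Data.Nat.DivMod using (%-distribˡ-+; m*n%n≡0)
open import Data.Nat.ListAction using (sum)
open import Data.Nat.Properties hiding (_≟_)
open import Data.Product using (_×_; _,_; proj₁; proj₂; Σ-syntax; ∃-syntax)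
open import Relation.Nullary using (yes; no; does; contradiction)
open import Relation.Binary.PropositionalEquality
  using (_≡_; refl; sym; trans; cong; cong₂; subst; subst₂; module ≡-Reasoning)

module _ {A : Set} where

  sum-map-cong : ∀ {f g : A → ℕ} → (∀ x → f x ≡ g x) → ∀ xs → sum (map f xs) ≡ sum (map g xs)
  sum-map-cong f≗g xs = cong sum (map-cong f≗g xs)

  sum-map-+ : ∀ (f g : A → ℕ) xs → sum (map (λ x → f x + g x) xs) ≡ sum (map f xs) + sum (map g xs)
  sum-map-+ f g []       = refl
  sum-map-+ f g (x ∷ xs) = trans (cong (f x + g x +_) (sum-map-+ f g xs))
                                 (interchange +-commutativeSemigroup (f x) (g x) _ _)

  sum-map-*ˡ : ∀ c (f : A → ℕ) xs → sum (map (λ x → c * f x) xs) ≡ c * sum (map f xs)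
  sum-map-*ˡ c f []       = sym (*-zeroʳ c)
  sum-map-*ˡ c f (x ∷ xs) = trans (cong (c * f x +_) (sum-map-*ˡ c f xs)) (sym (*-distribˡ-+ c (f x) _))

  sum-map-const : ∀ c (xs : List A) → sum (map (λ _ → c) xs) ≡ length xs * c
  sum-map-const c []       = refl
  sum-map-const c (x ∷ xs) = cong (c +_) (sum-map-const c xs)

  sum-map-mono : ∀ {f g : A → ℕ} → (∀ x → f x ≤ g x) → ∀ xs → sum (map f xs) ≤ sum (map g xs)
  sum-map-mono f≤g []       = z≤n
  sum-map-mono f≤g (x ∷ xs) = +-mono-≤ (f≤g x) (sum-map-mono f≤g xs)

  sum-map-mono-+ : ∀ {f g : A → ℕ} {x xs d} → (∀ y → g y ≤ f y) → x ∈ xs → g x + d ≤ f x →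
                   sum (map g xs) + d ≤ sum (map f xs)
  sum-map-mono-+ {f} {g} {xs = x ∷ xs} {d} g≤f (here refl) gx+d≤fx = begin
    g x + sum (map g xs) + d  ≡⟨ +-assoc (g x) _ d ⟩
    g x + (sum (map g xs) + d) ≡⟨ cong (g x +_) (+-comm _ d) ⟩
    g x + (d + sum (map g xs)) ≡⟨ +-assoc (g x) d _ ⟨
    g x + d + sum (map g xs)  ≤⟨ +-mono-≤ gx+d≤fx (sum-map-mono g≤f xs) ⟩
    f x + sum (map f xs)      ∎
    where open ≤-Reasoning
  sum-map-mono-+ {f} {g} {xs = y ∷ xs} {d} g≤f (there x∈xs) gx+d≤fx =
    subst (_≤ sum (map f (y ∷ xs))) (sym (+-assoc (g y) _ d))
          (+-mono-≤ (g≤f y) (sum-map-mono-+ g≤f x∈xs gx+d≤fx))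

  sum-map-tight : ∀ {f g : A → ℕ} {x xs} → (∀ y → g y ≤ f y) →
                  sum (map f xs) ≤ sum (map g xs) → x ∈ xs → f x ≤ g x
  sum-map-tight {f} {g} {x} {_ ∷ xs} g≤f Σf≤Σg (here refl) with f x ≤? g x
  ... | yes fx≤gx = fx≤gx
  ... | no  fx≰gx = contradiction (+-mono-<-≤ (≰⇒> fx≰gx) (sum-map-mono g≤f xs)) (≤⇒≯ Σf≤Σg)
  sum-map-tight {f} {g} {xs = y ∷ xs} g≤f Σf≤Σg (there x∈xs) =
    sum-map-tight g≤f (+-cancelˡ-≤ (g y) _ _ (≤-trans (+-monoˡ-≤ _ (g≤f y)) Σf≤Σg)) x∈xs

  sum-map-even : ∀ (f : A → ℕ) xs → (∀ x → x ∈ xs → f x % 2 ≡ 0) → sum (map f xs) % 2 ≡ 0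
  sum-map-even f []       _    = refl
  sum-map-even f (x ∷ xs) even = trans (%-distribˡ-+ (f x) _ 2)
    (cong₂ (λ a b → (a + b) % 2) (even x (here refl)) (sum-map-even f xs (λ y y∈xs → even y (there y∈xs))))

sum-map-swap : ∀ {A B : Set} (f : A → B → ℕ) xs ys →
  sum (map (λ x → sum (map (f x) ys)) xs) ≡ sum (map (λ y → sum (map (λ x → f x y) xs)) ys)
sum-map-swap f []       ys = sym (trans (sum-map-const 0 ys) (*-zeroʳ (length ys)))
sum-map-swap f (x ∷ xs) ys = trans (cong (sum (map (f x) ys) +_) (sum-map-swap f xs ys))
                                   (sym (sum-map-+ (f x) _ ys))

m+n≤m*[1+n] : ∀ m n .{{_ : NonZero m}} → m + n ≤ m * suc n
m+n≤m*[1+n] m n = subst (m + n ≤_) (sym (*-suc m n)) (+-monoʳ-≤ m (m≤n*m n m))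

even∧3≤n⇒4≤n : ∀ n → n % 2 ≡ 0 → 3 ≤ n → 4 ≤ n
even∧3≤n⇒4≤n 2 _ (s≤s (s≤s ()))
even∧3≤n⇒4≤n 3 () _
even∧3≤n⇒4≤n (suc (suc (suc (suc n)))) _ _ = s≤s (s≤s (s≤s (s≤s z≤n)))

clamp : ∀ {j k} → Fin k → Fin (suc j)
clamp zero                = zero
clamp {zero}  (suc i)     = zero
clamp {suc j} (suc i)     = suc (clamp i)

clamp-inject≤ : ∀ {j k} (i : Fin (suc j)) .(le : suc j ≤ k) → clamp (inject≤ i le) ≡ i
clamp-inject≤ {k = suc k} zero    le = refl
clamp-inject≤ {suc j} {suc k} (suc i) le = cong suc (clamp-inject≤ i (≤-pred le))

sum-map-allFin-suc : ∀ {k} (f : Fin (suc k) → ℕ) →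
  sum (map f (allFin (suc k))) ≡ f zero + sum (map (λ i → f (suc i)) (allFin k))
sum-map-allFin-suc {k} f = cong (λ fs → sum (f zero ∷ fs))
  (trans (map-tabulate suc f) (sym (map-tabulate (λ i → i) (λ i → f (suc i)))))

sum-map-[≟]≡1 : ∀ {k} (a : Fin k) → sum (map (λ v → [ does (a ≟ v) ]) (allFin k)) ≡ 1
sum-map-[≟]≡1 {suc k} zero = trans (sum-map-allFin-suc {k} (λ v → [ does (zero ≟ v) ])) (cong suc (trans (sum-map-const 0 (allFin k)) (*-zeroʳ (length (allFin k)))))
sum-map-[≟]≡1 {suc k} (suc a) = trans (sum-map-allFin-suc {k} (λ v → [ does (suc a ≟ v) ])) (sum-map-[≟]≡1 a)

xnor₃ : Bool → Bool → Bool → Bool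
xnor₃ x y z = not (x xor y xor z)

majority : Bool → Bool → Bool → Bool
majority x y z = (x ∧ y) ∨ (y ∧ z) ∨ (x ∧ z)

count : List Bool → ℕ
count bs = sum (map [_] bs)

[xnor₃]+count≡1+2*[majority] : ∀ x y z →
  [ xnor₃ x y z ] + count (x ∷ y ∷ z ∷ []) ≡ 1 + 2 * [ majority x y z ]
[xnor₃]+count≡1+2*[majority] true  true  true  = refl
[xnor₃]+count≡1+2*[majority] true  true  false = refl
[xnor₃]+count≡1+2*[majority] true  false true  = refl
[xnor₃]+count≡1+2*[majority] true  false false = refl
[xnor₃]+count≡1+2*[majority] false true  true  = refl
[xnor₃]+count≡1+2*[majority] false true  false = refl
[xnor₃]+count≡1+2*[majority] false false true  = refl
[xnor₃]+count≡1+2*[majority] false false false = refl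

leaveOneOut : ∀ {A : Set} → (A → A → A → A) → A → A → A → A → List A
leaveOneOut f a b c d = f b c d ∷ f a c d ∷ f a b d ∷ f a b c ∷ []

count-leaveOneOut-xnor₃ : ∀ a b c d → 1 ≤ count (a ∷ b ∷ c ∷ d ∷ []) → count (a ∷ b ∷ c ∷ d ∷ []) ≤ 3 →
  count (leaveOneOut xnor₃ a b c d) ≡ count (a ∷ b ∷ c ∷ d ∷ [])
count-leaveOneOut-xnor₃ true  true  true  true  _  (s≤s (s≤s (s≤s ())))
count-leaveOneOut-xnor₃ true  true  true  false _ _ = refl
count-leaveOneOut-xnor₃ true  true  false true  _ _ = refl
count-leaveOneOut-xnor₃ true  true  false false _ _ = refl
count-leaveOneOut-xnor₃ true  false true  true  _ _ = refl
count-leaveOneOut-xnor₃ true  false true  false _ _ = refl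
count-leaveOneOut-xnor₃ true  false false true  _ _ = refl
count-leaveOneOut-xnor₃ true  false false false _ _ = refl
count-leaveOneOut-xnor₃ false true  true  true  _ _ = refl
count-leaveOneOut-xnor₃ false true  true  false _ _ = refl
count-leaveOneOut-xnor₃ false true  false true  _ _ = refl
count-leaveOneOut-xnor₃ false true  false false _ _ = refl
count-leaveOneOut-xnor₃ false false true  true  _ _ = refl
count-leaveOneOut-xnor₃ false false true  false _ _ = refl
count-leaveOneOut-xnor₃ false false false true  _ _ = refl
count-leaveOneOut-xnor₃ false false false false () _

All-leaveOneOut : ∀ {A : Set} {P Q : A → Set} {f : A → A → A → A} →
  (∀ {x y z} → P x → P y → P z → Q (f x y z)) →
  ∀ {a b c d} → P a → P b → P c → P d → All Q (leaveOneOut f a b c d)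
All-leaveOneOut f-pres pa pb pc pd = f-pres pb pc pd ∷ f-pres pa pc pd ∷ f-pres pa pb pd ∷ f-pres pa pb pc ∷ []

module _ (G : Graph) where

  edges : List (Fin (m G))
  edges = allFin (m G)

  vertices : List (Fin (n G))
  vertices = allFin (n G)

  sum-vertices-const : ∀ c → sum (map (λ _ → c) vertices) ≡ n G * c
  sum-vertices-const c = trans (sum-map-const c vertices) (cong (_* c) (length-tabulate {n = n G} (λ v → v)))

  weightedDegree : (Fin (m G) → ℕ) → Fin (n G) → ℕ
  weightedDegree h v = sum (map (λ e → inc G e v * h e) edges)

  weightedDegree-+ : ∀ f g v → weightedDegree (λ e → f e + g e) v ≡ weightedDegree f v + weightedDegree g v
  weightedDegree-+ f g v =
    trans (sum-map-cong (λ e → *-distribˡ-+ (inc G e v) (f e) (g e)) edges) (sum-map-+ _ _ edges)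

  weightedDegree-*ˡ : ∀ c f v → weightedDegree (λ e → c * f e) v ≡ c * weightedDegree f v
  weightedDegree-*ˡ c f v =
    trans (sum-map-cong (λ e → x∙yz≈y∙xz *-commutativeSemigroup (inc G e v) c (f e)) edges) (sum-map-*ˡ c _ edges)

  weightedDegree-mono : ∀ {f g} → (∀ e → f e ≤ g e) → ∀ v → weightedDegree f v ≤ weightedDegree g v
  weightedDegree-mono f≤g v = sum-map-mono (λ e → *-monoʳ-≤ (inc G e v) (f≤g e)) edges

  deg≡weightedDegree : ∀ S v → deg G S v ≡ weightedDegree (λ e → [ S e ]) v
  deg≡weightedDegree S v = sum-map-cong term edges
    where
    term : ∀ e → (if S e then inc G e v else 0) ≡ inc G e v * [ S e ]
    term e with S e
    ... | true  = sym (*-identityʳ (inc G e v))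
    ... | false = sym (*-zeroʳ (inc G e v))

  sum-inc≡2 : ∀ e → sum (map (inc G e) vertices) ≡ 2
  sum-inc≡2 e = trans (sum-map-+ (λ v → [ does (proj₁ (ends G e) ≟ v) ]) (λ v → [ does (proj₂ (ends G e) ≟ v) ]) vertices)
    (cong₂ _+_ (sum-map-[≟]≡1 (proj₁ (ends G e))) (sum-map-[≟]≡1 (proj₂ (ends G e))))

  handshake : ∀ h → sum (map (weightedDegree h) vertices) ≡ 2 * sum (map h edges)
  handshake h = begin
    sum (map (λ v → sum (map (λ e → inc G e v * h e) edges)) vertices)
      ≡⟨ sum-map-swap (λ v e → inc G e v * h e) vertices edges ⟩
    sum (map (λ e → sum (map (λ v → inc G e v * h e) vertices)) edges)
      ≡⟨ sum-map-cong perEdge edges ⟩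
    sum (map (λ e → 2 * h e) edges)
      ≡⟨ sum-map-*ˡ 2 h edges ⟩
    2 * sum (map h edges) ∎
    where
    open ≡-Reasoning
    perEdge : ∀ e → sum (map (λ v → inc G e v * h e) vertices) ≡ 2 * h e
    perEdge e = begin
      sum (map (λ v → inc G e v * h e) vertices) ≡⟨ sum-map-cong (λ v → *-comm (inc G e v) (h e)) vertices ⟩
      sum (map (λ v → h e * inc G e v) vertices) ≡⟨ sum-map-*ˡ (h e) (inc G e) vertices ⟩
      h e * sum (map (inc G e) vertices)         ≡⟨ cong (h e *_) (sum-inc≡2 e) ⟩
      h e * 2                                   ≡⟨ *-comm (h e) 2 ⟩
      2 * h e                                   ∎

  inc-source≥1 : ∀ e → 1 ≤ inc G e (proj₁ (ends G e))
  inc-source≥1 e with proj₁ (ends G e) ≟ proj₁ (ends G e)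
  ... | yes _    = s≤s z≤n
  ... | no  u≢u = contradiction refl u≢u

  -- Every edge at u contributes at least its number of ends at u, and e at least h e − 1 more.
  deg+h≤1+weightedDegree : ∀ h → (∀ e → 1 ≤ h e) → ∀ e →
    deg G (allEdges G) (proj₁ (ends G e)) + h e ≤ suc (weightedDegree h (proj₁ (ends G e)))
  deg+h≤1+weightedDegree h h≥1 e with h e in he | h≥1 e
  ... | suc b | _ = subst (_≤ suc (weightedDegree h u)) (sym (+-suc _ b))
                  (s≤s (sum-map-mono-+ inc≤inc*h (∈-allFin e) inc+b≤inc*h))
    where
    u = proj₁ (ends G e)
    inc≤inc*h : ∀ e′ → inc G e′ u ≤ inc G e′ u * h e′
    inc≤inc*h e′ = m≤m*n (inc G e′ u) (h e′) {{>-nonZero (h≥1 e′)}}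
    inc+b≤inc*h : inc G e u + b ≤ inc G e u * h e
    inc+b≤inc*h rewrite he = m+n≤m*[1+n] (inc G e u) b {{>-nonZero (inc-source≥1 e)}}

  sum-deg≡weightedDegree-multiplicity : ∀ 𝒞 v →
    sum (map (λ C → deg G C v) 𝒞) ≡ weightedDegree (multiplicity G 𝒞) v
  sum-deg≡weightedDegree-multiplicity 𝒞 v = begin
    sum (map (λ C → deg G C v) 𝒞)
      ≡⟨ sum-map-cong (λ C → deg≡weightedDegree C v) 𝒞 ⟩
    sum (map (λ C → sum (map (λ e → inc G e v * [ C e ]) edges)) 𝒞)
      ≡⟨ sum-map-swap (λ C e → inc G e v * [ C e ]) 𝒞 edges ⟩
    sum (map (λ e → sum (map (λ C → inc G e v * [ C e ]) 𝒞)) edges)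
      ≡⟨ sum-map-cong (λ e → sum-map-*ˡ (inc G e v) (λ C → [ C e ]) 𝒞) edges ⟩
    weightedDegree (multiplicity G 𝒞) v ∎
    where open ≡-Reasoning

  sum-deg-perfectMatchings : ∀ {𝓜} → All (PerfectMatching G) 𝓜 → ∀ v →
    sum (map (λ M → deg G M v) 𝓜) ≡ length 𝓜
  sum-deg-perfectMatchings []         v = refl
  sum-deg-perfectMatchings (pm ∷ pms) v = cong₂ _+_ (pm v) (sum-deg-perfectMatchings pms v)

  coverLength≡sum-multiplicity : ∀ 𝒞 → coverLength G 𝒞 ≡ sum (map (multiplicity G 𝒞) edges)
  coverLength≡sum-multiplicity 𝒞 = sum-map-swap (λ C e → [ C e ]) 𝒞 edges

  sum-weightedDegree-multiplicity : ∀ 𝒞 →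
    sum (map (weightedDegree (multiplicity G 𝒞)) vertices) ≡ 2 * coverLength G 𝒞
  sum-weightedDegree-multiplicity 𝒞 =
    trans (handshake (multiplicity G 𝒞)) (cong (2 *_) (sym (coverLength≡sum-multiplicity 𝒞)))

  2*coverLength-perfectMatchings : ∀ {𝓜} → All (PerfectMatching G) 𝓜 →
    2 * coverLength G 𝓜 ≡ n G * length 𝓜
  2*coverLength-perfectMatchings {𝓜} pms = begin
    2 * coverLength G 𝓜                                    ≡⟨ sum-weightedDegree-multiplicity 𝓜 ⟨
    sum (map (weightedDegree (multiplicity G 𝓜)) vertices) ≡⟨ sum-map-cong length≡ vertices ⟩
    sum (map (λ _ → length 𝓜) vertices)                    ≡⟨ sum-vertices-const (length 𝓜) ⟩
    n G * length 𝓜                                         ∎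
    where
    open ≡-Reasoning
    length≡ : ∀ v → weightedDegree (multiplicity G 𝓜) v ≡ length 𝓜
    length≡ v = trans (sym (sum-deg≡weightedDegree-multiplicity 𝓜 v)) (sum-deg-perfectMatchings pms v)

  multiplicity≥1 : ∀ {𝒞 C} e → C ∈ 𝒞 → C e ≡ true → 1 ≤ multiplicity G 𝒞 e
  multiplicity≥1 e (here refl) Ce rewrite Ce = s≤s z≤n
  multiplicity≥1 {C′ ∷ _} e (there C∈𝒞) Ce = ≤-trans (multiplicity≥1 e C∈𝒞 Ce) (m≤n+m _ [ C′ e ])

  multiplicity≥1⇒covered : ∀ 𝒞 e → 1 ≤ multiplicity G 𝒞 e → ∃[ C ] (C ∈ 𝒞 × C e ≡ true)
  multiplicity≥1⇒covered (C ∷ 𝒞) e mult≥1 with C e in Ce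
  ... | true  = C , here refl , Ce
  ... | false = let C′ , C′∈𝒞 , C′e = multiplicity≥1⇒covered 𝒞 e mult≥1 in C′ , there C′∈𝒞 , C′e

  coSymDiff : EdgeSet G → EdgeSet G → EdgeSet G → EdgeSet G
  coSymDiff a b c e = xnor₃ (a e) (b e) (c e)

  coSymDiff-isCycle : Cubic G → ∀ {a b c} → PerfectMatching G a → PerfectMatching G b →
    PerfectMatching G c → IsCycle G (coSymDiff a b c)
  coSymDiff-isCycle cubic {a} {b} {c} pa pb pc v =
    subst (λ k → k % 2 ≡ 0) (sym (trans deg≡ (*-comm 2 (weightedDegree maj v)))) (m*n%n≡0 (weightedDegree maj v) 2)
    where
    open ≡-Reasoning
    C   = coSymDiff a b c
    abc = a ∷ b ∷ c ∷ []
    maj = λ e → [ majority (a e) (b e) (c e) ]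
    three≡ : 3 ≡ weightedDegree (multiplicity G abc) v
    three≡ = trans (sym (sum-deg-perfectMatchings (pa ∷ pb ∷ pc ∷ []) v)) (sum-deg≡weightedDegree-multiplicity abc v)
    deg+3≡ : deg G C v + 3 ≡ 2 * weightedDegree maj v + 3
    deg+3≡ = begin
      deg G C v + 3
        ≡⟨ cong₂ _+_ (deg≡weightedDegree C v) three≡ ⟩
      weightedDegree (λ e → [ C e ]) v + weightedDegree (multiplicity G abc) v
        ≡⟨ weightedDegree-+ (λ e → [ C e ]) (multiplicity G abc) v ⟨
      weightedDegree (λ e → [ C e ] + multiplicity G abc e) v
        ≡⟨ sum-map-cong (λ e → cong (inc G e v *_) ([xnor₃]+count≡1+2*[majority] (a e) (b e) (c e))) edges ⟩
      weightedDegree (λ e → 1 + 2 * maj e) v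
        ≡⟨ weightedDegree-+ (λ _ → 1) (λ e → 2 * maj e) v ⟩
      weightedDegree (λ _ → 1) v + weightedDegree (λ e → 2 * maj e) v
        ≡⟨ cong₂ _+_ (trans (sym (deg≡weightedDegree (allEdges G) v)) (cubic v)) (weightedDegree-*ˡ 2 maj v) ⟩
      3 + 2 * weightedDegree maj v
        ≡⟨ +-comm 3 _ ⟩
      2 * weightedDegree maj v + 3 ∎
    deg≡ : deg G C v ≡ 2 * weightedDegree maj v
    deg≡ = +-cancelʳ-≡ 3 _ _ deg+3≡

  CoveringMatchings : ℕ → Set
  CoveringMatchings k = Σ[ M ∈ (Fin k → EdgeSet G) ]
    ((∀ i → PerfectMatching G (M i)) × (∀ e → ∃[ i ] M i e ≡ true))

  coveringMatchings-pad : ∀ {j k} → suc j ≤ k → CoveringMatchings (suc j) → CoveringMatchings k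
  coveringMatchings-pad j<k (M , pm , covers) = (λ i → M (clamp i)) , (λ i → pm (clamp i)) , covered
    where
    covered : ∀ e → ∃[ i ] M (clamp i) e ≡ true
    covered e = let i , Mie = covers e in
      inject≤ i j<k , subst (λ i′ → M i′ e ≡ true) (sym (clamp-inject≤ i j<k)) Mie

  fourMatchings⇒cycleCover : Cubic G → CoveringMatchings 4 →
    Σ[ 𝒟 ∈ List (EdgeSet G) ] (IsCycleCover G 𝒟 × coverLength G 𝒟 ≡ 2 * n G)
  fourMatchings⇒cycleCover cubic (M , pm , covers) = 𝒟 , (cycles , covered) , length≡
    where
    𝓜 = map M (allFin 4)
    𝒟 = leaveOneOut coSymDiff (M (# 0)) (M (# 1)) (M (# 2)) (M (# 3))
    pms : All (PerfectMatching G) 𝓜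
    pms = pm _ ∷ pm _ ∷ pm _ ∷ pm _ ∷ []
    weight≡4 : ∀ v → weightedDegree (multiplicity G 𝓜) v ≡ 4
    weight≡4 v = trans (sym (sum-deg≡weightedDegree-multiplicity 𝓜 v)) (sum-deg-perfectMatchings pms v)
    mult𝓜≥1 : ∀ e → 1 ≤ multiplicity G 𝓜 e
    mult𝓜≥1 e = let i , Mie = covers e in multiplicity≥1 e (∈-map⁺ M (∈-allFin i)) Mie
    mult𝓜≤2 : ∀ e → multiplicity G 𝓜 e ≤ 2
    mult𝓜≤2 e = +-cancelˡ-≤ 3 _ 2 (subst₂ (λ d w → d + multiplicity G 𝓜 e ≤ suc w)
      (cubic _) (weight≡4 _) (deg+h≤1+weightedDegree (multiplicity G 𝓜) mult𝓜≥1 e))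
    mult𝒟≡mult𝓜 : ∀ e → multiplicity G 𝒟 e ≡ multiplicity G 𝓜 e
    mult𝒟≡mult𝓜 e = count-leaveOneOut-xnor₃ (M (# 0) e) (M (# 1) e) (M (# 2) e) (M (# 3) e)
      (mult𝓜≥1 e) (m≤n⇒m≤1+n (mult𝓜≤2 e))
    cycles : ∀ C → C ∈ 𝒟 → IsCycle G C
    cycles _ = lookup (All-leaveOneOut {P = PerfectMatching G} {Q = IsCycle G} {f = coSymDiff}
                                       (coSymDiff-isCycle cubic) (pm _) (pm _) (pm _) (pm _))
    covered : ∀ e → ∃[ C ] (C ∈ 𝒟 × C e ≡ true)
    covered e = multiplicity≥1⇒covered 𝒟 e (subst (1 ≤_) (sym (mult𝒟≡mult𝓜 e)) (mult𝓜≥1 e))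
    length≡ : coverLength G 𝒟 ≡ 2 * n G
    length≡ = *-cancelˡ-≡ _ _ 2 (begin
      2 * coverLength G 𝒟                          ≡⟨ cong (2 *_) (coverLength≡sum-multiplicity 𝒟) ⟩
      2 * sum (map (multiplicity G 𝒟) edges)       ≡⟨ cong (2 *_) (sum-map-cong mult𝒟≡mult𝓜 edges) ⟩
      2 * sum (map (multiplicity G 𝓜) edges)       ≡⟨ cong (2 *_) (coverLength≡sum-multiplicity 𝓜) ⟨
      2 * coverLength G 𝓜                          ≡⟨ 2*coverLength-perfectMatchings pms ⟩
      n G * 4                                      ≡⟨ trans (*-comm (n G) 4) (*-assoc 2 2 (n G)) ⟩
      2 * (2 * n G)                                ∎)
      where open ≡-Reasoning

  shortCycleCover : Cubic G → PMIndexAtMost G 4 →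
    Σ[ 𝒟 ∈ List (EdgeSet G) ] (IsCycleCover G 𝒟 × coverLength G 𝒟 ≤ 2 * n G)
  shortCycleCover cubic (zero , _ , _ , _ , covers) =
    [] , ((λ _ ()) , λ e → contradiction (proj₁ (covers e)) ¬Fin0) , z≤n
  shortCycleCover cubic (suc j , j<4 , matchings)
    with fourMatchings⇒cycleCover cubic (coveringMatchings-pad j<4 matchings)
  ... | 𝒟 , cover , length≡ = 𝒟 , cover , ≤-reflexive length≡

  coverLength≤2n⇒is12Cover : Cubic G → ∀ {𝒞} → IsCycleCover G 𝒞 → coverLength G 𝒞 ≤ 2 * n G → Is12Cover G 𝒞
  coverLength≤2n⇒is12Cover cubic {𝒞} (cycles , covers) short = (cycles , covers) , λ e → mult≥1 e , mult≤2 e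
    where
    weight = weightedDegree (multiplicity G 𝒞)
    mult≥1 : ∀ e → 1 ≤ multiplicity G 𝒞 e
    mult≥1 e = let C , C∈𝒞 , Ce = covers e in multiplicity≥1 e C∈𝒞 Ce
    4≤weight : ∀ v → 4 ≤ weight v
    4≤weight v = even∧3≤n⇒4≤n (weight v)
      (subst (λ k → k % 2 ≡ 0) (sum-deg≡weightedDegree-multiplicity 𝒞 v)
        (sum-map-even (λ C → deg G C v) 𝒞 (λ C C∈𝒞 → cycles C C∈𝒞 v)))
      (subst (_≤ weight v) (trans (sym (deg≡weightedDegree (allEdges G) v)) (cubic v))
        (weightedDegree-mono mult≥1 v))
    total : sum (map weight vertices) ≤ sum (map (λ _ → 4) vertices)
    total = begin
      sum (map weight vertices)         ≡⟨ sum-weightedDegree-multiplicity 𝒞 ⟩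
      2 * coverLength G 𝒞               ≤⟨ *-monoʳ-≤ 2 short ⟩
      2 * (2 * n G)                     ≡⟨ trans (*-comm (n G) 4) (*-assoc 2 2 (n G)) ⟨
      n G * 4                           ≡⟨ sum-vertices-const 4 ⟨
      sum (map (λ _ → 4) vertices)      ∎
      where open ≤-Reasoning
    mult≤2 : ∀ e → multiplicity G 𝒞 e ≤ 2
    mult≤2 e = +-cancelˡ-≤ 3 _ 2 (≤-trans
      (subst (λ d → d + multiplicity G 𝒞 e ≤ suc (weight u)) (cubic u) (deg+h≤1+weightedDegree _ mult≥1 e))
      (s≤s (sum-map-tight 4≤weight total (∈-allFin u))))
      where u = proj₁ (ends G e)

-- Bridgelessness only ensures that τ(G) exists; here τ(G) ≤ 4 is assumed outright.
mainTheorem7 : (G : Graph) → Cubic G → Bridgeless G → PMIndexAtMost G 4 →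
    ∀ 𝒞 → IsMinimumCycleCover G 𝒞 → Is12Cover G 𝒞
mainTheorem7 G cubic _ τ≤4 𝒞 (cover , minimal) =
  let 𝒟 , cover𝒟 , short = shortCycleCover G cubic τ≤4 in
  coverLength≤2n⇒is12Cover G cubic cover (≤-trans (minimal 𝒟 cover𝒟) short)
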